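{- Let $\Sigma_A$ be a finite alphabet, let $\leftarrow$ be a letter not in $\Sigma_A$, and let $\Sigma:=\Sigma_A\cup\{\leftarrow\}$. Let $A\subseteq\Sigma_A^\omega$ be an $\omega$-power of a language $L_A\subseteq\Sigma_A^{<\omega}$, i.e. $A=L_A^\infty$. Then $A^\approx$ is also an $\omega$-power: there exists a language $E_A\subseteq\Sigma^{<\omega}$ such that $A^\approx=E_A^\infty$. Moreover, if $L_A$ belongs to the class $OCL(k)$ for some natural number $k$, then such a language $E_A$ can be found in the class $OCL(k+1)$.
   Context: For a finite alphabet $\Gamma$, $\Gamma^{<\omega}$ is the set of finite words over $\Gamma$ (including the empty word $\lambda$), $\Gamma^\omega$ the set of infinite words, and $\Gamma^{\leq\omega}=\Gamma^{<\omega}\cup\Gamma^\omega$. For $L\subseteq\Gamma^{<\omega}$, the $\omega$-power of $L$ is $L^\infty:=\{w_0w_1w_2\ldots\in\Gamma^\omega \mid \forall i\in\omega\ w_i\in L\}$ (infinite concatenations). The operation $x\mapsto x^\leftarrow$ (a partial map on $\Sigma^{\leq\omega}$, where $\leftarrow$ acts as a backspace): $\lambda^\leftarrow:=\lambda$; for a finite word $u\in\Sigma^{<\omega}$ with $u^\leftarrow$ defined: $(ua)^\leftarrow:=u^\leftarrow a$ if $a\in\Sigma_A$; $(u\leftarrow)^\leftarrow:=u^\leftarrow$ with its last letter removed if $|u^\leftarrow|>0$; $(u\leftarrow)^\leftarrow$ is undefined if $|u^\leftarrow|=0$ (and it is undefined whenever $u^\leftarrow$ is undefined). For an infinite word $\sigma\in\Sigma^\omega$,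 $\sigma^\leftarrow:=\lim_{n\in\omega}(\sigma|n)^\leftarrow$, where $\sigma|n$ is the prefix of length $n$ and, for a sequence $(w_n)$ of finite words over $\Sigma_A$, $\lim_n w_n$ is the finite or infinite word determined by: a finite word $w$ is a prefix of $\lim_n w_n$ iff there is $p$ such that for all $n\ge p$, $w$ is a prefix of $w_n$. For $A\subseteq\Sigma_A^{\leq\omega}$, $A^\approx:=\{x\in\Sigma^{\leq\omega}\mid x^\leftarrow \text{ is defined and } x^\leftarrow\in A\}$. Substitutions: for finite alphabets $\Sigma',\Gamma$, a $(\Sigma',\Gamma)$-substitution is a map $f:\Sigma'\to 2^{\Gamma^{<\omega}}$, extended to words by $f(a_0\ldots a_{l-1}):=\{w_0\ldots w_{l-1}\mid w_i\in f(a_i)\}$ and to languages by $f(L):=\bigcup_{w\in L}f(w)$. If $\mathcal F$ is a family of languages, $f$ is an $\mathcal F$-substitution if $f(a)\in\mathcal F$ for every letter $a$. For families $\mathcal E,\mathcal F$, $\mathcal E\,\square\,\mathcal F:=\{f(L)\mid L\in\mathcal E,\ f \text{ an } \mathcal F\text{ -substitution}\}$. A one-counter automaton is a (nondeterministic, possibly with $\lambda$-transitions) pushdown automaton whose pushdown alphabet is $\{Z_0,z\}$, where $Z_0$ is a bottom symbol that always remains at the bottom of the stack, accepting finite words by final state; a one-counter language is a language accepted by such an automaton. $OCL(0):=REG$ (regular languages), $OCL(1):=OCL$ (one-counter languages), and $OCL(k+1):=OCL(k)\,\square\, OCL$ for $k\ge 1$. -}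

module Defs where

open import Level using (Lift)
open import Data.Nat using (ℕ; zero; suc; _≤_)
open import Data.Fin using (Fin; zero; suc)
open import Data.List using (List; []; _∷_; _++_; _∷ʳ_; length; reverse; foldl)
open import Data.Maybe using (Maybe; just; nothing)
import Data.Maybe as Maybe
open import Data.Bool using (Bool; true; false; T)
open import Data.Product using (Σ; ∃; _×_; _,_)
open import Data.List.Membership.Propositional using (_∈_)
open import Relation.Binary.PropositionalEquality using (_≡_)
open import Function.Bundles using (_⇔_)

Lang : ℕ → Set₁
Lang m = List (Fin m) → Set

InfWord : ℕ → Set
InfWord m = ℕ → Fin m

IsPrefix : ∀ {m} → List (Fin m) → List (Fin m) → Set
IsPrefix u v = ∃ λ w → u ++ w ≡ v

pref : ∀ {m} → InfWord m → ℕ → List (Fin m)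
pref σ zero = []
pref σ (suc n) = pref σ n ∷ʳ σ n

IsPrefixInf : ∀ {m} → List (Fin m) → InfWord m → Set
IsPrefixInf u σ = pref σ (length u) ≡ u

concatN : ∀ {m} → (ℕ → List (Fin m)) → ℕ → List (Fin m)
concatN w zero = []
concatN w (suc k) = concatN w k ++ w k

-- σ is the (infinite) concatenation w₀ w₁ w₂ … : every finite partial
-- concatenation is a prefix of σ and their lengths are unbounded (so the
-- concatenation is an infinite word, which then equals σ).
IsInfConcat : ∀ {m} → (ℕ → List (Fin m)) → InfWord m → Set
IsInfConcat w σ =
  (∀ k → IsPrefixInf (concatN w k) σ) × (∀ l → ∃ λ k → l ≤ length (concatN w k))

OmegaPower : ∀ {m} → Lang m → InfWord m → Set
OmegaPower {m} L σ = ∃ λ (w : ℕ → List (Fin m)) → (∀ i → L (w i)) × IsInfConcat w σ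

-- The backspace alphabet.  Σ_A = Fin n, Σ = Fin (suc n); the letter a of
-- Σ_A is embedded as inject₁ a, and the backspace ← is the last letter
-- fromℕ n.  `classify x` returns just a if x = inject₁ a, nothing if x = ←.

classify : ∀ {n} → Fin (suc n) → Maybe (Fin n)
classify {zero} zero = nothing
classify {suc n} zero = just zero
classify {suc n} (suc i) = Maybe.map suc (classify {n} i)

-- one step of the backspace operation on the (reversed) current result
stepBS : ∀ {n} → Maybe (List (Fin n)) → Fin (suc n) → Maybe (List (Fin n))
stepBS nothing x = nothing
stepBS (just r) x with classify x
... | just a = just (a ∷ r)
... | nothing with r
...   | [] = nothing
...   | (_ ∷ r') = just r'

-- u^← for finite u (partial: nothing = undefined)
backspace : ∀ {n} → List (Fin (suc n)) → Maybe (List (Fin n))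
backspace u = Maybe.map reverse (foldl stepBS (just []) u)

IsLimitInf : ∀ {n} → (ℕ → List (Fin n)) → InfWord n → Set
IsLimitInf ws α =
  ∀ w → (∃ λ p → ∀ k → p ≤ k → IsPrefix w (ws k)) ⇔ IsPrefixInf w α

BackspaceInf : ∀ {n} → InfWord (suc n) → InfWord n → Set
BackspaceInf σ α =
  ∃ λ ws → (∀ k → backspace (pref σ k) ≡ just (ws k)) × IsLimitInf ws α

-- A^≈ for A ⊆ Σ_A^ω, restricted to infinite words x ∈ Σ^ω
-- (finite x have finite x^←, which never lies in A ⊆ Σ_A^ω).
Approx : ∀ {n} → (InfWord n → Set) → InfWord (suc n) → Set
Approx A σ = ∃ λ α → BackspaceInf σ α × A α

record DFA (m : ℕ) : Set where
  field
    Q     : ℕ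
    init  : Fin Q
    final : Fin Q → Bool
    δ     : Fin Q → Fin m → Fin Q

runDFA : ∀ {m} (D : DFA m) → Fin (DFA.Q D) → List (Fin m) → Fin (DFA.Q D)
runDFA D q [] = q
runDFA D q (a ∷ u) = runDFA D (DFA.δ D q a) u

IsRegular : ∀ {m} → Lang m → Set
IsRegular {m} L = ∃ λ (D : DFA m) →
  ∀ w → L w ⇔ T (DFA.final D (runDFA D (DFA.init D) w))

-- One-counter automata: pushdown automata with stack alphabet {Z₀, z},
-- Z₀ always at the bottom.  A stack Z₀ z^c is represented by c : ℕ.
-- A transition (q, input a or λ, top X) → (q', γ):
--   top = Z₀ (onZ0 = true):  Z₀ replaced by Z₀ z^push
--   top = z  (onZ0 = false): z  replaced by z^push
-- Acceptance: by final state.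

record Trans (m Q : ℕ) : Set where
  field
    from  : Fin Q
    input : Maybe (Fin m)
    onZ0  : Bool
    to    : Fin Q
    push  : ℕ

record OCA (m : ℕ) : Set where
  field
    Q     : ℕ
    init  : Fin Q
    final : Fin Q → Bool
    δ     : List (Trans m Q)

Config : ℕ → Set
Config Q = Fin Q × ℕ

data StackStep : Bool → ℕ → ℕ → ℕ → Set where
  onBottom : ∀ j → StackStep true j zero j
  onZ      : ∀ j c → StackStep false j (suc c) (c Data.Nat.+ j)

inputWord : ∀ {m} → Maybe (Fin m) → List (Fin m)
inputWord nothing = []
inputWord (just a) = a ∷ []

data Reach {m} (M : OCA m) : Config (OCA.Q M) → List (Fin m) → Config (OCA.Q M) → Set where
  done : ∀ c → Reach M c [] c
  step : ∀ {q s s' w c''} (t : Trans m (OCA.Q M)) →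
         t ∈ OCA.δ M →
         q ≡ Trans.from t →
         StackStep (Trans.onZ0 t) (Trans.push t) s s' →
         Reach M (Trans.to t , s') w c'' →
         Reach M (q , s) (inputWord (Trans.input t) ++ w) c''

AcceptsOCA : ∀ {m} → OCA m → List (Fin m) → Set
AcceptsOCA M w = ∃ λ q → ∃ λ s →
  Reach M (OCA.init M , zero) w (q , s) × T (OCA.final M q)

IsOCL : ∀ {m} → Lang m → Set
IsOCL {m} L = ∃ λ (M : OCA m) → ∀ w → L w ⇔ AcceptsOCA M w

data SubstWord {m' m} (f : Fin m' → Lang m) : List (Fin m') → List (Fin m) → Set where
  []  : SubstWord f [] []
  _∷_ : ∀ {a u v w} → f a v → SubstWord f u w → SubstWord f (a ∷ u) (v ++ w)

Subst : ∀ {m' m} → (Fin m' → Lang m) → Lang m' → Lang m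
Subst f L w = ∃ λ u → L u × SubstWord f u w

-- OCL(k):  OCL(0) = REG, OCL(1) = OCL, OCL(k+1) = OCL(k) □ OCL

OCLk : ℕ → (m : ℕ) → Lang m → Set₁
OCLk zero m L = Lift _ (IsRegular L)
OCLk (suc zero) m L = Lift _ (IsOCL L)
OCLk (suc (suc k)) m L =
  Σ ℕ λ m' → Σ (Lang m') λ L' → OCLk (suc k) m' L' ×
    Σ (Fin m' → Lang m) λ f → (∀ a → IsOCL (f a)) ×
      (∀ w → L w ⇔ Subst f L' w)

module Submission where

-- For A = L^∞ ⊆ Σ_A^ω, the set A^≈ of infinite keystroke words whose
-- backspace-reduct lies in A is again an ω-power: A^≈ = E^∞ for E = f(L),
-- where f is the substitution a ↦ { u | u^← = a }.
--
-- The typed word is kept reversed, as a stack (screen u = reverse u^←).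

open import Defs
open import Level using (lift)
open import Data.Nat using (ℕ; zero; suc; _+_; _*_; _∸_; _≤_; _<_; z≤n; s≤s; _≤?_)
open import Data.Nat.Properties
  using (≤-refl; ≤-reflexive; ≤-trans; ≤-antisym; ≤-total; ≤-pred; <-irrefl; <-≤-trans; ≤-<-trans;
         <⇒≤; ≰⇒>;
         n<1+n; n≤1+n; m≤n⇒m≤1+n; m≤n⇒m<n∨m≡n; m≤m+n; m≤n+m; m<m+n; +-comm; +-identityʳ;
         m∸n+n≡m; m+n∸n≡m; ∸-monoˡ-≤; suc-injective; 0≢1+n; module ≤-Reasoning)
open import Data.Fin using (Fin; zero; suc; combine; remQuot; _≟_)
open import Data.Fin.Properties using (remQuot-combine)
open import Data.List using (List; []; _∷_; _++_; _∷ʳ_; length; reverse; foldl; allFin; tail; concatMap)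
open import Data.List.Properties
  using (foldl-++; reverse-++; reverse-involutive; ++-assoc; ++-identityʳ; length-++;
         unfold-reverse; length-reverse; ∷-injective; ++-cancelˡ; ++-cancelʳ; ++-conicalʳ)
open import Data.List.Reverse using (Reverse; []; _∶_∶ʳ_; reverseView)
open import Data.List.Relation.Unary.All using (All; []; _∷_; lookup)
open import Data.List.Relation.Unary.Any using (here; there; satisfied)
open import Data.List.Membership.Propositional using (_∈_; lose)
open import Data.List.Membership.Propositional.Properties using (∈-allFin; ∈-concatMap⁺; ∈-concatMap⁻)
open import Data.Maybe using (Maybe; just; nothing)
open import Data.Maybe.Properties using (just-injective)
open import Data.Bool using (Bool; true; false; T)
open import Data.Unit using (⊤; tt)
open import Data.Product using (Σ; ∃; _×_; _,_; proj₁; proj₂)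
open import Data.Sum using (_⊎_; inj₁; inj₂)
open import Data.Empty using (⊥-elim)
open import Relation.Binary.PropositionalEquality
open import Relation.Nullary using (¬_; Dec; yes; no)
open import Function.Bundles using (_⇔_; mk⇔; Equivalence)
open import Function.Construct.Composition using (_⇔-∘_)
open import Function.Construct.Symmetry using (⇔-sym)

-- Finite words and their prefixes

module _ {A : Set} where

  ∷≢[] : ∀ {a : A} {l : List A} → a ∷ l ≢ []
  ∷≢[] ()

  infix 4 _⊑_

  _⊑_ : List A → List A → Set
  u ⊑ v = ∃ λ w → u ++ w ≡ v

  ⊑-refl : ∀ u → u ⊑ u
  ⊑-refl u = [] , ++-identityʳ u

  ⊑-trans : ∀ {u v w} → u ⊑ v → v ⊑ w → u ⊑ w
  ⊑-trans {u} (a , refl) (b , refl) = a ++ b , sym (++-assoc u a b)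

  ⊑-length : ∀ {u v} → u ⊑ v → length u ≤ length v
  ⊑-length {u} (a , refl) = subst (length u ≤_) (sym (length-++ u)) (m≤m+n _ _)

  ⊑-compare : ∀ x y {z} → x ⊑ z → y ⊑ z → length x ≤ length y → x ⊑ y
  ⊑-compare [] y _ _ _ = y , refl
  ⊑-compare (p ∷ x) (q ∷ y) (a , e₁) (b , e₂) (s≤s le) with ∷-injective (trans e₂ (sym e₁))
  ... | refl , e with ⊑-compare x y (a , refl) (b , e) le
  ...   | c , e′ = c , cong (p ∷_) e′

  ⊑-same-length : ∀ {x y} → x ⊑ y → length x ≡ length y → x ≡ y
  ⊑-same-length {x} (c , refl) e with c
  ... | [] = sym (++-identityʳ x)
  ... | _ ∷ c′ = ⊥-elim (<-irrefl e (subst (length x <_) (sym (length-++ x))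
                                        (m<m+n (length x) (s≤s z≤n))))

  ⊑-unique : ∀ {x y z} → x ⊑ z → y ⊑ z → length x ≡ length y → x ≡ y
  ⊑-unique {x} {y} p q e = ⊑-same-length (⊑-compare x y p q (≤-reflexive e)) e

  nth : (l : List A) (j : ℕ) → j < length l → A
  nth (x ∷ l) zero _ = x
  nth (x ∷ l) (suc j) (s≤s p) = nth l j p

  nth-⊑ : ∀ {l l′} j p p′ → l ⊑ l′ → nth l j p ≡ nth l′ j p′
  nth-⊑ {_ ∷ _} zero p p′ (_ , refl) = refl
  nth-⊑ {_ ∷ l} (suc j) (s≤s p) (s≤s p′) (c , refl) = nth-⊑ {l} j p p′ (c , refl)

  nth-middle : ∀ x (y : A) rest p → nth (x ++ y ∷ rest) (length x) p ≡ y
  nth-middle [] y rest p = refl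
  nth-middle (a ∷ x) y rest (s≤s p) = nth-middle x y rest p

  ⊑-extend : ∀ x z p → x ⊑ z → x ∷ʳ nth z (length x) p ⊑ z
  ⊑-extend x z p ([] , refl) =
    ⊥-elim (<-irrefl refl (subst (λ l → length x < length l) (++-identityʳ x) p))
  ⊑-extend x z p (y ∷ rest , refl) =
    rest , trans (cong (λ l → (x ∷ʳ l) ++ rest) (nth-middle x y rest p)) (++-assoc x (y ∷ []) rest)

  bottom⇒⊑ : ∀ {x y} s → reverse y ≡ s ++ reverse x → x ⊑ y
  bottom⇒⊑ {x} {y} s e = reverse s , (begin
    x ++ reverse s                 ≡⟨ cong (_++ reverse s) (sym (reverse-involutive x)) ⟩
    reverse (reverse x) ++ reverse s ≡⟨ sym (reverse-++ s (reverse x)) ⟩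
    reverse (s ++ reverse x)         ≡⟨ cong reverse (sym e) ⟩
    reverse (reverse y)              ≡⟨ reverse-involutive y ⟩
    y                                ∎)
    where open ≡-Reasoning

module _ {m : ℕ} where

  length-pref : ∀ (σ : InfWord m) k → length (pref σ k) ≡ k
  length-pref σ zero = refl
  length-pref σ (suc k) = trans (length-++ (pref σ k)) (trans (+-comm _ 1) (cong suc (length-pref σ k)))

  chain-⊑ : ∀ (u : ℕ → List (Fin m)) → (∀ k → u k ⊑ u (suc k)) →
    ∀ {a b} → a ≤ b → u a ⊑ u b
  chain-⊑ u grow {a} {zero} z≤n = ⊑-refl _
  chain-⊑ u grow {a} {suc b} le with m≤n⇒m<n∨m≡n le
  ... | inj₂ refl = ⊑-refl _
  ... | inj₁ (s≤s le′) = ⊑-trans (chain-⊑ u grow le′) (grow b)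

  pref-⊑ : ∀ (σ : InfWord m) {a b} → a ≤ b → pref σ a ⊑ pref σ b
  pref-⊑ σ = chain-⊑ (pref σ) (λ k → σ k ∷ [] , refl)

  concatN-⊑ : ∀ (w : ℕ → List (Fin m)) {a b} → a ≤ b → concatN w a ⊑ concatN w b
  concatN-⊑ w = chain-⊑ (concatN w) (λ k → w k , refl)

  concatN-mono : ∀ (w : ℕ → List (Fin m)) {a b} → a ≤ b → length (concatN w a) ≤ length (concatN w b)
  concatN-mono w le = ⊑-length (concatN-⊑ w le)

-- The backspace machine.  The word typed so far is kept reversed, as a
-- stack whose top is the last typed letter; a backspace pops it.
-- Undefinedness (nothing) is absorbing.

typeOn : ∀ {n} → Maybe (List (Fin n)) → List (Fin (suc n)) → Maybe (List (Fin n))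
typeOn = foldl stepBS

-- screen u = reverse (u^←), when defined
screen : ∀ {n} → List (Fin (suc n)) → Maybe (List (Fin n))
screen = typeOn (just [])

data KeyView {n} (x : Fin (suc n)) : Set where
  letter : (a : Fin n) → classify x ≡ just a → KeyView x
  erase  : classify x ≡ nothing → KeyView x

keyView : ∀ {n} (x : Fin (suc n)) → KeyView x
keyView x with classify x in e
... | just a = letter a e
... | nothing = erase e

nothing≢just : ∀ {A : Set} {a : A} → nothing ≢ just a
nothing≢just ()

stepBS-letter : ∀ {n} {x : Fin (suc n)} {a} → classify x ≡ just a →
  ∀ r → stepBS (just r) x ≡ just (a ∷ r)
stepBS-letter {x = x} c r with classify x
stepBS-letter refl r | just _ = refl

stepBS-erase : ∀ {n} {x : Fin (suc n)} → classify x ≡ nothing → ∀ r → stepBS (just r) x ≡ tail r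
stepBS-erase {x = x} c r with classify x
stepBS-erase refl [] | nothing = refl
stepBS-erase refl (_ ∷ _) | nothing = refl

stepBS-letter-inv : ∀ {n} {x : Fin (suc n)} {a r t} → classify x ≡ just a → stepBS (just r) x ≡ just t →
  t ≡ a ∷ r
stepBS-letter-inv {r = r} c e = just-injective (trans (sym e) (stepBS-letter c r))

stepBS-erase-inv : ∀ {n} {x : Fin (suc n)} {r t} → classify x ≡ nothing → stepBS (just r) x ≡ just t →
  ∃ λ y → r ≡ y ∷ t
stepBS-erase-inv {r = []} c e = ⊥-elim (nothing≢just (trans (sym (stepBS-erase c [])) e))
stepBS-erase-inv {r = y ∷ r} c e = y , cong (y ∷_) (just-injective (trans (sym (stepBS-erase c (y ∷ r))) e))

stepBS-length : ∀ {n} {x : Fin (suc n)} {r t} → stepBS (just r) x ≡ just t → length t ≤ suc (length r)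
stepBS-length {x = x} e with keyView x
... | letter a c rewrite stepBS-letter-inv c e = ≤-refl
... | erase c with stepBS-erase-inv c e
...   | _ , refl = m≤n⇒m≤1+n (n≤1+n _)

-- Frame rule: a successful step never inspects the stack below its
-- starting contents, so those can be arbitrary.
stepBS-frame : ∀ {n} (s r : List (Fin n)) x {s′} → stepBS (just s) x ≡ just s′ →
  stepBS (just (s ++ r)) x ≡ just (s′ ++ r)
stepBS-frame s r x e with keyView x
... | letter a c rewrite stepBS-letter-inv c e = stepBS-letter c (s ++ r)
... | erase c with stepBS-erase-inv c e
...   | y , refl = stepBS-erase c (y ∷ _ ++ r)

typeOn-crashed : ∀ {n} (u : List (Fin (suc n))) → typeOn nothing u ≡ nothing
typeOn-crashed [] = refl
typeOn-crashed (x ∷ u) = typeOn-crashed u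

typeOn-++ : ∀ {n} (s : Maybe (List (Fin n))) u v → typeOn s (u ++ v) ≡ typeOn (typeOn s u) v
typeOn-++ = foldl-++ stepBS

typeOn-prefix : ∀ {n} (s : Maybe (List (Fin n))) u v {t} → typeOn s (u ++ v) ≡ just t →
  ∃ λ t₀ → typeOn s u ≡ just t₀
typeOn-prefix s u v eq with typeOn s u in e
... | just t₀ = t₀ , refl
... | nothing = ⊥-elim (nothing≢just (begin
  nothing               ≡⟨ sym (typeOn-crashed v) ⟩
  typeOn nothing v      ≡⟨ cong (λ z → typeOn z v) (sym e) ⟩
  typeOn (typeOn s u) v ≡⟨ sym (typeOn-++ s u v) ⟩
  typeOn s (u ++ v)     ≡⟨ eq ⟩
  just _                ∎))
  where open ≡-Reasoning

typeOn-frame : ∀ {n} (u : List (Fin (suc n))) s {s′} r → typeOn (just s) u ≡ just s′ →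
  typeOn (just (s ++ r)) u ≡ just (s′ ++ r)
typeOn-frame [] s r refl = refl
typeOn-frame (x ∷ u) s r eq with stepBS (just s) x in e
... | nothing = ⊥-elim (nothing≢just (trans (sym (typeOn-crashed u)) eq))
... | just s₁ rewrite stepBS-frame s r x e = typeOn-frame u s₁ r eq

screen-++ : ∀ {n} (u v : List (Fin (suc n))) {s t} → screen u ≡ just s → screen v ≡ just t →
  screen (u ++ v) ≡ just (t ++ s)
screen-++ u v {s} eu ev = trans (typeOn-++ (just []) u v)
                          (trans (cong (λ z → typeOn z v) eu) (typeOn-frame v [] s ev))

screen-snoc : ∀ {n} (u : List (Fin (suc n))) {x r t} → screen u ≡ just r → stepBS (just r) x ≡ just t →
  screen (u ∷ʳ x) ≡ just t
screen-snoc u {x} eu ex = trans (typeOn-++ (just []) u (x ∷ [])) (trans (cong (λ z → stepBS z x) eu) ex)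

screen-step : ∀ {n} (u : List (Fin (suc n))) {x r t} → screen u ≡ just r → screen (u ∷ʳ x) ≡ just t →
  stepBS (just r) x ≡ just t
screen-step u {x} eu et =
  trans (cong (λ z → stepBS z x) (sym eu)) (trans (sym (typeOn-++ (just []) u (x ∷ []))) et)

screen-last : ∀ {n} (u : List (Fin (suc n))) x {t} → screen (u ∷ʳ x) ≡ just t →
  ∃ λ r → screen u ≡ just r × stepBS (just r) x ≡ just t
screen-last u x eq with typeOn-prefix (just []) u (x ∷ []) eq
... | r , er = r , er , screen-step u er eq

-- If the stack ends as s′ on top of s, then u splits at the last moment
-- the stack was exactly s; the rest of u types s′ on its own.
screen-split : ∀ {n} (u : List (Fin (suc n))) s s′ → screen u ≡ just (s′ ++ s) →
  ∃ λ u₁ → ∃ λ u₂ → (u ≡ u₁ ++ u₂) × (screen u₁ ≡ just s) × (screen u₂ ≡ just s′)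
screen-split u = go u (reverseView u)
  where
  go : ∀ {n} (u : List (Fin (suc n))) → Reverse u → ∀ s s′ → screen u ≡ just (s′ ++ s) →
    ∃ λ u₁ → ∃ λ u₂ → (u ≡ u₁ ++ u₂) × (screen u₁ ≡ just s) × (screen u₂ ≡ just s′)
  go .[] [] s [] eq = [] , [] , refl , eq , refl
  go .[] [] s (_ ∷ _) ()
  go .(u ∷ʳ x) (u ∶ rv ∶ʳ x) s [] eq = u ∷ʳ x , [] , sym (++-identityʳ _) , eq , refl
  go .(u ∷ʳ x) (u ∶ rv ∶ʳ x) s (b ∷ s′) eq with screen-last u x eq | keyView x
  ... | r , er , ex | letter a c with stepBS-letter-inv c ex
  ...   | refl with go u rv s s′ er
  ...     | u₁ , u₂ , refl , e₁ , e₂ =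
          u₁ , u₂ ∷ʳ x , ++-assoc u₁ u₂ (x ∷ []) , e₁ , screen-snoc u₂ e₂ (stepBS-letter c s′)
  go .(u ∷ʳ x) (u ∶ rv ∶ʳ x) s (b ∷ s′) eq | r , er , ex | erase c with stepBS-erase-inv c ex
  ... | y , refl with go u rv s (y ∷ b ∷ s′) er
  ...   | u₁ , u₂ , refl , e₁ , e₂ =
          u₁ , u₂ ∷ʳ x , ++-assoc u₁ u₂ (x ∷ []) , e₁ ,
          screen-snoc u₂ e₂ (stepBS-erase c (y ∷ b ∷ s′))

screen⇒backspace : ∀ {n} (u : List (Fin (suc n))) {w} → screen u ≡ just (reverse w) → backspace u ≡ just w
screen⇒backspace u eq with screen u
screen⇒backspace u {w} refl | just _ = cong just (reverse-involutive w)

backspace⇒screen : ∀ {n} (u : List (Fin (suc n))) {w} → backspace u ≡ just w → screen u ≡ just (reverse w)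
backspace⇒screen u eq with screen u
backspace⇒screen u refl | just r = cong just (sym (reverse-involutive r))

Types : ∀ {n} → Fin n → Lang (suc n)
Types a u = backspace u ≡ just (a ∷ [])

Typing : ∀ {n} → Lang n → Lang (suc n)
Typing L u = ∃ λ w → L w × (screen u ≡ just (reverse w)) × (w ≡ [] → u ≡ [])

substWord-Types⇒ : ∀ {n} {w : List (Fin n)} {u} → SubstWord Types w u →
  (screen u ≡ just (reverse w)) × (w ≡ [] → u ≡ [])
substWord-Types⇒ [] = refl , λ _ → refl
substWord-Types⇒ {w = a ∷ w} (_∷_ {v = v} {w = u} tv rest) =
  trans (screen-++ v u (backspace⇒screen v tv) (proj₁ (substWord-Types⇒ rest)))
        (cong just (sym (unfold-reverse a w))) ,
  λ ()

substWord-Types⇐ : ∀ {n} (w : List (Fin n)) u → screen u ≡ just (reverse w) → (w ≡ [] → u ≡ []) →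
  SubstWord Types w u
substWord-Types⇐ [] u _ empty rewrite empty refl = []
substWord-Types⇐ (a ∷ []) u eq _ =
  subst (SubstWord Types (a ∷ [])) (++-identityʳ u) (screen⇒backspace u eq ∷ [])
substWord-Types⇐ (a ∷ b ∷ w) u eq _ =
  glue (screen-split u (a ∷ []) (reverse (b ∷ w)) (trans eq (cong just (unfold-reverse a (b ∷ w)))))
       (λ u₂ e₂ → substWord-Types⇐ (b ∷ w) u₂ e₂ (λ ()))
  where
  glue : (∃ λ u₁ → ∃ λ u₂ → (u ≡ u₁ ++ u₂) × (screen u₁ ≡ just (a ∷ []))
                            × (screen u₂ ≡ just (reverse (b ∷ w)))) →
    (∀ u₂ → screen u₂ ≡ just (reverse (b ∷ w)) → SubstWord Types (b ∷ w) u₂) →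
    SubstWord Types (a ∷ b ∷ w) u
  glue (u₁ , u₂ , refl , e₁ , e₂) rest = screen⇒backspace u₁ e₁ ∷ rest u₂ e₂

Subst-Types⇔Typing : ∀ {n} (L : Lang n) u → Subst Types L u ⇔ Typing L u
Subst-Types⇔Typing L u =
  mk⇔ (λ { (w , Lw , sw) → w , Lw , substWord-Types⇒ sw })
      (λ { (w , Lw , e , empty) → w , Lw , substWord-Types⇐ w u e empty })

-- Infinite words as limits of finite approximations

module _ {m : ℕ} where

  prefixInf-⊑ : ∀ {u} {α : InfWord m} → IsPrefixInf u α → ∀ {l} → l ≤ length u → pref α l ⊑ u
  prefixInf-⊑ {u} {α} e {l} le = subst (pref α l ⊑_) e (pref-⊑ α le)

  concatN-limit : (v : ℕ → List (Fin m)) → (∀ l → ∃ λ i → l ≤ length (concatN v i)) →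
    ∃ λ (α : InfWord m) → ∀ i → IsPrefixInf (concatN v i) α
  concatN-limit v unbounded = α , λ i → ⊑-same-length (pref-α-⊑ _ i ≤-refl) (length-pref α _)
    where
    W : ℕ → List (Fin m)
    W = concatN v

    α : InfWord m
    α j = nth (W (proj₁ (unbounded (suc j)))) j (proj₂ (unbounded (suc j)))

    α-nth : ∀ i j (p : j < length (W i)) → α j ≡ nth (W i) j p
    α-nth i j p with ≤-total (proj₁ (unbounded (suc j))) i
    ... | inj₁ le = nth-⊑ j _ p (concatN-⊑ v le)
    ... | inj₂ le = sym (nth-⊑ j p _ (concatN-⊑ v le))

    pref-α-⊑ : ∀ l i → l ≤ length (W i) → pref α l ⊑ W i
    pref-α-⊑ zero i le = W i , refl
    pref-α-⊑ (suc l) i le =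
      subst (λ a → pref α l ∷ʳ a ⊑ W i) next-letter
            (⊑-extend (pref α l) (W i) p (pref-α-⊑ l i (<⇒≤ le)))
      where
      p : length (pref α l) < length (W i)
      p = subst (_< length (W i)) (sym (length-pref α l)) le
      next-letter : nth (W i) (length (pref α l)) p ≡ α l
      next-letter = trans (sym (α-nth i _ p)) (cong α (length-pref α l))

  limit-from-approximants : (ws : ℕ → List (Fin m)) (α : InfWord m) (W : ℕ → List (Fin m)) →
    (∀ i → IsPrefixInf (W i) α) → (∀ l → ∃ λ i → l ≤ length (W i)) →
    (∀ i → ∃ λ p → ∀ k → p ≤ k → W i ⊑ ws k) → IsLimitInf ws α
  limit-from-approximants ws α W prefW unbounded eventually w with unbounded (length w)
  ... | i , w-fits with eventually i
  ...   | q , Wi⊑ws = mk⇔ to from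
    where
    to : (∃ λ p → ∀ k → p ≤ k → IsPrefix w (ws k)) → IsPrefixInf w α
    to (p , w⊑ws) = ⊑-unique (prefixInf-⊑ (prefW i) w-fits) w⊑Wi (length-pref α _)
      where
      w⊑Wi : w ⊑ W i
      w⊑Wi = ⊑-compare w (W i) (w⊑ws (p + q) (m≤m+n p q)) (Wi⊑ws (p + q) (m≤n+m q p)) w-fits

    from : IsPrefixInf w α → ∃ λ p → ∀ k → p ≤ k → IsPrefix w (ws k)
    from e = q , λ k q≤k → ⊑-trans (subst (_⊑ W i) e (prefixInf-⊑ (prefW i) w-fits)) (Wi⊑ws k q≤k)

-- E^∞ ⊆ A^≈ : an infinite concatenation of words of Typing L types an
-- infinite concatenation of words of L.

module FromPieces {n} (L : Lang n) (σ : InfWord (suc n)) (u : ℕ → List (Fin (suc n)))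
                  (typed : ∀ i → Typing L (u i)) (cat : IsInfConcat u σ) where

  v : ℕ → List (Fin n)
  v i = proj₁ (typed i)

  P : ℕ → List (Fin (suc n))
  P = concatN u

  W : ℕ → List (Fin n)
  W = concatN v

  screen-u : ∀ i → screen (u i) ≡ just (reverse (v i))
  screen-u i = proj₁ (proj₂ (proj₂ (typed i)))

  screen-P : ∀ i → screen (P i) ≡ just (reverse (W i))
  screen-P zero = refl
  screen-P (suc i) = trans (screen-++ (P i) (u i) (screen-P i) (screen-u i))
                           (cong just (sym (reverse-++ (W i) (v i))))

  pref-P : ∀ i → pref σ (length (P i)) ≡ P i
  pref-P i = proj₁ cat i

  block-typed : ∀ e i → ∃ λ Q → (P i ++ Q ≡ P (e + i)) × ∃ λ s → screen Q ≡ just s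
  block-typed zero i = [] , ++-identityʳ _ , [] , refl
  block-typed (suc e) i with block-typed e i
  ... | Q , eQ , s , sQ = Q ++ u (e + i) , trans (sym (++-assoc (P i) Q _)) (cong (_++ u (e + i)) eQ) ,
                          _ , screen-++ Q (u (e + i)) sQ (screen-u (e + i))

  rest-typed : ∀ i k → length (P i) ≤ k →
    ∃ λ t → (P i ++ t ≡ pref σ k) × ∃ λ s → screen t ≡ just s
  rest-typed i k le with subst (_⊑ pref σ k) (pref-P i) (pref-⊑ σ le)
                       | proj₂ cat k | block-typed (proj₁ (proj₂ cat k)) i
  ... | t , et | e , k≤ | Q , eQ , _ , sQ with subst (pref σ k ⊑_) (pref-P (e + i))
                                                     (pref-⊑ σ (≤-trans k≤ (concatN-mono u (m≤m+n e i))))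
  ...   | t′ , et′ = t , et , typeOn-prefix (just []) t t′ (trans (cong screen t++t′≡Q) sQ)
    where
    t++t′≡Q : t ++ t′ ≡ Q
    t++t′≡Q = ++-cancelˡ (P i) (t ++ t′) Q (begin
      P i ++ (t ++ t′) ≡⟨ sym (++-assoc (P i) t t′) ⟩
      (P i ++ t) ++ t′ ≡⟨ cong (_++ t′) et ⟩
      pref σ k ++ t′   ≡⟨ et′ ⟩
      P (e + i)        ≡⟨ sym eQ ⟩
      P i ++ Q         ∎)
      where open ≡-Reasoning

  -- once P i has been read, the typed word W i is never erased
  screen-keeps-W : ∀ i k → length (P i) ≤ k → ∃ λ s → screen (pref σ k) ≡ just (s ++ reverse (W i))
  screen-keeps-W i k le with rest-typed i k le
  ... | t , et , s , st = s , trans (cong screen (sym et)) (screen-++ (P i) t (screen-P i) st)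

  screen-σ : ∀ k → ∃ λ t → screen (pref σ k) ≡ just t
  screen-σ k with screen-keeps-W 0 k z≤n
  ... | s , e = s ++ [] , e

  ws : ℕ → List (Fin n)
  ws k = reverse (proj₁ (screen-σ k))

  screen-ws : ∀ k → screen (pref σ k) ≡ just (reverse (ws k))
  screen-ws k = trans (proj₂ (screen-σ k)) (cong just (sym (reverse-involutive (proj₁ (screen-σ k)))))

  W⊑ws : ∀ i k → length (P i) ≤ k → W i ⊑ ws k
  W⊑ws i k le with screen-keeps-W i k le
  ... | s , e = bottom⇒⊑ s (just-injective (trans (sym (screen-ws k)) e))

  P-unchanged : ∀ i → v i ≡ [] → length (P (suc i)) ≡ length (P i)
  P-unchanged i e =
    cong length (trans (cong (P i ++_) (proj₂ (proj₂ (proj₂ (typed i))) e)) (++-identityʳ (P i)))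

  W-grows : ∀ a b → length (P a) < length (P b) → length (W a) < length (W b)
  W-grows a zero ()
  W-grows a (suc b) lt with a ≤? b
  ... | no a≰b = ⊥-elim (<-irrefl refl (<-≤-trans lt (concatN-mono u {suc b} {a} (≰⇒> a≰b))))
  ... | yes a≤b with v b in ev
  ...   | [] = subst (length (W a) <_) (sym (cong length (++-identityʳ (W b))))
                 (W-grows a b (subst (length (P a) <_) (P-unchanged b ev) lt))
  ...   | _ ∷ _ = ≤-<-trans (concatN-mono v a≤b)
                    (subst (length (W b) <_) (sym (length-++ (W b))) (m<m+n (length (W b)) (s≤s z≤n)))

  W-unbounded : ∀ l → ∃ λ i → l ≤ length (W i)
  W-unbounded zero = 0 , z≤n
  W-unbounded (suc l) with W-unbounded l
  ... | i , le with proj₂ cat (suc (length (P i)))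
  ...   | k , lt = k , ≤-<-trans le (W-grows i k lt)

  α : InfWord n
  α = proj₁ (concatN-limit v W-unbounded)

  approx : Approx (OmegaPower L) σ
  approx = α , (ws , (λ k → screen⇒backspace (pref σ k) (screen-ws k)) , limit) ,
           (v , (λ i → proj₁ (proj₂ (typed i))) , proj₂ (concatN-limit v W-unbounded) , W-unbounded)
    where
    limit : IsLimitInf ws α
    limit = limit-from-approximants ws α W (proj₂ (concatN-limit v W-unbounded)) W-unbounded
                                    (λ i → length (P i) , W⊑ws i)

last-below : (p : ℕ → Set) → (∀ k → Dec (p k)) → p 0 → ∀ D →
  ∃ λ e → (e ≤ D) × p e × (∀ f → e < f → f ≤ D → ¬ p f)
last-below p p? p0 zero = 0 , z≤n , p0 , λ f lt le → ⊥-elim (<-irrefl refl (<-≤-trans lt le))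
last-below p p? p0 (suc D) with p? (suc D)
... | yes pD = suc D , ≤-refl , pD , λ f lt le → ⊥-elim (<-irrefl refl (<-≤-trans lt le))
... | no ¬pD with last-below p p? p0 D
...   | e , e≤D , pe , after = e , m≤n⇒m≤1+n e≤D , pe , after′
  where
  after′ : ∀ f → e < f → f ≤ suc D → ¬ p f
  after′ f lt le with m≤n⇒m<n∨m≡n le
  ... | inj₂ refl = ¬pD
  ... | inj₁ (s≤s le′) = after f lt le′

from-offset : ∀ (p : ℕ → Set) e c → (∀ f → e ≤ f → p (f + c)) → ∀ k → e + c ≤ k → p k
from-offset p e c h k le =
  subst p (m∸n+n≡m (≤-trans (m≤n+m c e) le))
          (h (k ∸ c) (subst (_≤ k ∸ c) (m+n∸n≡m e c) (∸-monoˡ-≤ c le)))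

-- A^≈ ⊆ E^∞ : if σ^← = v₀ v₁ v₂ … with vᵢ ∈ L, then σ is cut into pieces
-- typing v₀, v₁, v₂, … respectively.  The i-th cut is a moment c at which
-- the screen shows exactly v₀ … v_{i-1} and never shrinks below it again.

module ToPieces {n} (L : Lang n) (σ : InfWord (suc n)) (α : InfWord n) (ws : ℕ → List (Fin n))
                (bk : ∀ k → backspace (pref σ k) ≡ just (ws k)) (lim : IsLimitInf ws α)
                (v : ℕ → List (Fin n)) (inL : ∀ i → L (v i)) (cat : IsInfConcat v α) where

  W : ℕ → List (Fin n)
  W = concatN v

  St : ℕ → List (Fin n)
  St k = reverse (ws k)

  screen-St : ∀ k → screen (pref σ k) ≡ just (St k)
  screen-St k = backspace⇒screen (pref σ k) (bk k)

  step-St : ∀ k → stepBS (just (St k)) (σ k) ≡ just (St (suc k))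
  step-St k = screen-step (pref σ k) (screen-St k) (screen-St (suc k))

  ws-step : ∀ k → length (ws (suc k)) ≤ suc (length (ws k))
  ws-step k = subst₂ (λ a b → a ≤ suc b) (length-reverse (ws (suc k))) (length-reverse (ws k))
                     (stepBS-length (step-St k))

  ws-zero : ws 0 ≡ []
  ws-zero = sym (just-injective (bk 0))

  ws-length : ∀ k → length (ws k) ≤ k
  ws-length zero = subst (λ z → length z ≤ 0) (sym ws-zero) z≤n
  ws-length (suc k) = ≤-trans (ws-step k) (s≤s (ws-length k))

  seg : ℕ → ℕ → List (Fin (suc n))
  seg c zero = []
  seg c (suc d) = seg c d ∷ʳ σ (d + c)

  pref-seg : ∀ c d → pref σ (d + c) ≡ pref σ c ++ seg c d
  pref-seg c zero = sym (++-identityʳ _)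
  pref-seg c (suc d) =
    trans (cong (_∷ʳ σ (d + c)) (pref-seg c d)) (++-assoc (pref σ c) (seg c d) (σ (d + c) ∷ []))

  -- If the stack never gets lower than at time c, its contents at time c
  -- stay at the bottom, and what lies above them is typed by the keys since c.
  stable-bottom : ∀ c → (∀ k → c ≤ k → length (ws c) ≤ length (ws k)) → ∀ d →
    ∃ λ s → (St (d + c) ≡ s ++ St c) × (screen (seg c d) ≡ just s)
  stable-bottom c H zero = [] , refl , refl
  stable-bottom c H (suc d) with stable-bottom c H d | keyView (σ (d + c))
  ... | s , e₁ , e₂ | letter a cl =
        a ∷ s , trans (stepBS-letter-inv cl (step-St (d + c))) (cong (a ∷_) e₁) ,
        screen-snoc (seg c d) e₂ (stepBS-letter cl s)
  ... | s , e₁ , e₂ | erase cl with stepBS-erase-inv cl (step-St (d + c))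
  ...   | y , e with s
  ...     | y′ ∷ s′ = s′ , proj₂ (∷-injective (trans (sym e) e₁)) ,
                      screen-snoc (seg c d) e₂ (stepBS-erase cl (y′ ∷ s′))
  ...     | [] = ⊥-elim (<-irrefl refl (<-≤-trans too-low (H (suc d + c) (m≤n+m c (suc d)))))
    where
    too-low : length (ws (suc d + c)) < length (ws c)
    too-low = begin-strict
      length (ws (suc d + c))      ≡⟨ sym (length-reverse (ws (suc d + c))) ⟩
      length (St (suc d + c))      <⟨ n<1+n _ ⟩
      length (y ∷ St (suc d + c))  ≡⟨ cong length (trans (sym e) e₁) ⟩
      length (St c)                ≡⟨ length-reverse (ws c) ⟩
      length (ws c)                ∎
      where open ≤-Reasoning

  settle : ∀ c m D → length (ws c) ≤ m → (∀ k → D ≤ k → m ≤ length (ws k)) →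
    ∃ λ e → (length (ws (e + c)) ≡ m) × (∀ k → e + c ≤ k → m ≤ length (ws k))
  settle c m D start end
    with last-below (λ e → length (ws (e + c)) ≤ m) (λ e → length (ws (e + c)) ≤? m) start D
  ... | e , _ , low , after =
        e , ≤-antisym low (above e ≤-refl) , from-offset (λ k → m ≤ length (ws k)) e c above
    where
    above : ∀ f → e ≤ f → m ≤ length (ws (f + c))
    above f e≤f with D ≤? f
    ... | yes D≤f = end (f + c) (≤-trans D≤f (m≤m+n f c))
    ... | no D≰f with m≤n⇒m<n∨m≡n e≤f
    ...   | inj₁ e<f = <⇒≤ (≰⇒> (after f e<f (<⇒≤ (≰⇒> D≰f))))
    ...   | inj₂ refl = ≤-pred (<-≤-trans (≰⇒> (after (suc e) (n<1+n e) (≰⇒> D≰f))) (ws-step (e + c)))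

  Cut : ℕ → ℕ → Set
  Cut i c = (ws c ≡ W i) × (∀ k → c ≤ k → length (W i) ≤ length (ws k))

  record NextCut (i c : ℕ) : Set where
    field
      d     : ℕ
      cut   : Cut (suc i) (d + c)
      types : screen (seg c d) ≡ just (reverse (v i))
      empty : v i ≡ [] → seg c d ≡ []

  next-cut-empty : ∀ i c → Cut i c → v i ≡ [] → NextCut i c
  next-cut-empty i c (ws≡W , stays) e = record
    { d = 0
    ; cut = trans ws≡W (sym W-same) , λ k le → subst (_≤ length (ws k)) (cong length (sym W-same)) (stays k le)
    ; types = cong (λ z → just (reverse z)) (sym e)
    ; empty = λ _ → refl }
    where
    W-same : W (suc i) ≡ W i
    W-same = trans (cong (W i ++_) e) (++-identityʳ (W i))

  -- the next cut is the moment after which the screen no longer drops below the length of W (suc i)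
  next-cut-nonempty : ∀ i c → Cut i c → v i ≢ [] → NextCut i c
  next-cut-nonempty i c (ws≡W , stays) v≢[]
    with Equivalence.from (lim (W (suc i))) (proj₁ cat (suc i))
  ... | D , W⊑ws with settle c (length (W (suc i))) D
                        (subst (_≤ length (W (suc i))) (cong length (sym ws≡W))
                               (⊑-length {u = W i} (v i , refl)))
                        (λ k le → ⊑-length (W⊑ws k le))
  ...   | e , exact , high
    with stable-bottom c (λ k le → subst (_≤ length (ws k)) (cong length (sym ws≡W)) (stays k le)) e
  ...     | s , St≡ , types-s = record
    { d = e
    ; cut = ws≡W′ , high
    ; types = trans types-s (cong just (++-cancelʳ (St c) s (reverse (v i)) (begin
        s ++ St c                  ≡⟨ sym St≡ ⟩
        St (e + c)                 ≡⟨ cong reverse ws≡W′ ⟩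
        reverse (W i ++ v i)       ≡⟨ reverse-++ (W i) (v i) ⟩
        reverse (v i) ++ reverse (W i) ≡⟨ cong (λ z → reverse (v i) ++ reverse z) (sym ws≡W) ⟩
        reverse (v i) ++ St c      ∎)))
    ; empty = λ e → ⊥-elim (v≢[] e) }
    where
    open ≡-Reasoning
    -- from time e + c on, the screen keeps ws (e + c) at the bottom, so ws (e + c) = W (suc i)
    ws≡W′ : ws (e + c) ≡ W (suc i)
    ws≡W′ with stable-bottom (e + c) (λ k le → subst (_≤ length (ws k)) (sym exact) (high k le)) D
    ... | s′ , e′ , _ = ⊑-unique (bottom⇒⊑ s′ e′) (W⊑ws (D + (e + c)) (m≤m+n D _)) exact

  next-cut : ∀ i c → Cut i c → NextCut i c
  next-cut i c cut with v i in e
  ... | [] = next-cut-empty i c cut e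
  ... | _ ∷ _ = next-cut-nonempty i c cut (λ e′ → ∷≢[] (trans (sym e) e′))

  cut-after : ∀ {i} c → NextCut i c → Σ ℕ (Cut (suc i))
  cut-after c next = NextCut.d next + c , NextCut.cut next

  cut : ∀ i → Σ ℕ (Cut i)
  cut zero = 0 , ws-zero , λ k _ → z≤n
  cut (suc i) = cut-after (proj₁ (cut i)) (next-cut i (proj₁ (cut i)) (proj₂ (cut i)))

  next : ∀ i → NextCut i (proj₁ (cut i))
  next i = next-cut i (proj₁ (cut i)) (proj₂ (cut i))

  piece : ℕ → List (Fin (suc n))
  piece i = seg (proj₁ (cut i)) (NextCut.d (next i))

  concat-piece : ∀ i → concatN piece i ≡ pref σ (proj₁ (cut i))
  concat-piece zero = refl
  concat-piece (suc i) =
    trans (cong (_++ piece i) (concat-piece i)) (sym (pref-seg (proj₁ (cut i)) (NextCut.d (next i))))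

  pieces : OmegaPower (Typing L) σ
  pieces = piece , (λ i → v i , inL i , NextCut.types (next i) , NextCut.empty (next i)) , prefixes , unbounded
    where
    prefixes : ∀ i → IsPrefixInf (concatN piece i) σ
    prefixes i rewrite concat-piece i = cong (pref σ) (length-pref σ (proj₁ (cut i)))

    -- the i-th cut lies beyond the length of W i
    unbounded : ∀ l → ∃ λ i → l ≤ length (concatN piece i)
    unbounded l with proj₂ cat l
    ... | i , l≤ = i , (begin
      l                              ≤⟨ l≤ ⟩
      length (W i)                   ≡⟨ cong length (sym (proj₁ (proj₂ (cut i)))) ⟩
      length (ws (proj₁ (cut i)))    ≤⟨ ws-length (proj₁ (cut i)) ⟩
      proj₁ (cut i)                  ≡⟨ sym (length-pref σ _) ⟩
      length (pref σ (proj₁ (cut i))) ≡⟨ cong length (sym (concat-piece i)) ⟩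
      length (concatN piece i)       ∎)
      where open ≤-Reasoning

approx⇔pieces : ∀ {n} (L : Lang n) σ → Approx (OmegaPower L) σ ⇔ OmegaPower (Typing L) σ
approx⇔pieces L σ =
  mk⇔ (λ { (α , (ws , bk , lim) , (v , inL , cat)) → ToPieces.pieces L σ α ws bk lim v inL cat })
      (λ { (u , typed , cat) → FromPieces.approx L σ u typed cat })

omegaPower-cong : ∀ {m} {L L′ : Lang m} → (∀ u → L u ⇔ L′ u) →
  ∀ σ → OmegaPower L σ ⇔ OmegaPower L′ σ
omegaPower-cong L⇔L′ σ =
  mk⇔ (λ { (w , inL , cat) → w , (λ i → Equivalence.to (L⇔L′ (w i)) (inL i)) , cat })
      (λ { (w , inL′ , cat) → w , (λ i → Equivalence.from (L⇔L′ (w i)) (inL′ i)) , cat })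

approx⇔omegaPower-Subst : ∀ {n} (L : Lang n) σ → Approx (OmegaPower L) σ ⇔ OmegaPower (Subst Types L) σ
approx⇔omegaPower-Subst L σ =
  omegaPower-cong (λ u → ⇔-sym (Subst-Types⇔Typing L u)) σ ⇔-∘ approx⇔pieces L σ

-- The automaton runs the DFA of L on the committed letters, i.e. those
-- that will never be erased, and guesses for every other typed letter that
-- it is pending: the counter holds the number of pending letters, and a
-- backspace erases the last of them.  A mode records whether nothing has
-- been read yet (fresh), the committed word w is still empty (idle), w is
-- nonempty (committed), or the run has been closed without pending letters
-- (closed); fresh and closed states are final when the DFA state is.

runDFA-++ : ∀ {m} (D : DFA m) q u v → runDFA D q (u ++ v) ≡ runDFA D (runDFA D q u) v
runDFA-++ D q [] v = refl
runDFA-++ D q (a ∷ u) v = runDFA-++ D (DFA.δ D q a) u v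

data Mode : Set where
  fresh idle committed closed : Mode

modes : List Mode
modes = fresh ∷ idle ∷ committed ∷ closed ∷ []

mode∈modes : ∀ m → m ∈ modes
mode∈modes fresh = here refl
mode∈modes idle = there (here refl)
mode∈modes committed = there (there (here refl))
mode∈modes closed = there (there (there (here refl)))

modeToFin : Mode → Fin 4
modeToFin fresh = zero
modeToFin idle = suc zero
modeToFin committed = suc (suc zero)
modeToFin closed = suc (suc (suc zero))

modeFromFin : Fin 4 → Mode
modeFromFin zero = fresh
modeFromFin (suc zero) = idle
modeFromFin (suc (suc zero)) = committed
modeFromFin (suc (suc (suc zero))) = closed

modeFromFin-toFin : ∀ m → modeFromFin (modeToFin m) ≡ m
modeFromFin-toFin fresh = refl
modeFromFin-toFin idle = refl
modeFromFin-toFin committed = refl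
modeFromFin-toFin closed = refl

afterKey : Mode → Mode
afterKey committed = committed
afterKey _ = idle

module Automaton {n} (L : Lang n) (D : DFA n)
                 (D-accepts : ∀ w → L w ⇔ T (DFA.final D (runDFA D (DFA.init D) w))) where

  Q : ℕ
  Q = DFA.Q D

  q₀ : Fin Q
  q₀ = DFA.init D

  ⟨_,_⟩ : Fin Q → Mode → Fin (Q * 4)
  ⟨ q , m ⟩ = combine q (modeToFin m)

  decode : Fin (Q * 4) → Fin Q × Mode
  decode p = proj₁ (remQuot {Q} 4 p) , modeFromFin (proj₂ (remQuot {Q} 4 p))

  decode-⟨⟩ : ∀ q m → decode ⟨ q , m ⟩ ≡ (q , m)
  decode-⟨⟩ q m =
    trans (cong (λ z → proj₁ z , modeFromFin (proj₂ z)) (remQuot-combine {Q} {4} q (modeToFin m)))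
          (cong (q ,_) (modeFromFin-toFin m))

  isFinal : Fin Q × Mode → Bool
  isFinal (q , fresh) = DFA.final D q
  isFinal (q , closed) = DFA.final D q
  isFinal _ = false

  Tr : Set
  Tr = Trans (suc n) (Q * 4)

  closeT : Fin Q → Tr
  closeT q = record { from = ⟨ q , committed ⟩ ; input = nothing ; onZ0 = true
                    ; to = ⟨ q , closed ⟩ ; push = 0 }

  commitT : Fin Q → Fin (suc n) → Mode → Fin n → Tr
  commitT q x m a = record { from = ⟨ q , m ⟩ ; input = just x ; onZ0 = true
                           ; to = ⟨ DFA.δ D q a , committed ⟩ ; push = 0 }

  pendT₀ pendT : Fin Q → Fin (suc n) → Mode → Tr
  pendT₀ q x m = record { from = ⟨ q , m ⟩ ; input = just x ; onZ0 = true
                        ; to = ⟨ q , afterKey m ⟩ ; push = 1 }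
  pendT q x m = record { from = ⟨ q , m ⟩ ; input = just x ; onZ0 = false
                       ; to = ⟨ q , afterKey m ⟩ ; push = 2 }

  popT : Fin Q → Fin (suc n) → Mode → Tr
  popT q x m = record { from = ⟨ q , m ⟩ ; input = just x ; onZ0 = false
                      ; to = ⟨ q , afterKey m ⟩ ; push = 0 }

  keyTransitions : Fin Q → Fin (suc n) → Mode → Maybe (Fin n) → List Tr
  keyTransitions q x m (just a) = commitT q x m a ∷ pendT₀ q x m ∷ pendT q x m ∷ []
  keyTransitions q x m nothing = popT q x m ∷ []

  modeTransitions : Fin Q → Fin (suc n) → Mode → List Tr
  modeTransitions q x m = keyTransitions q x m (classify x)

  stateTransitions : Fin Q → List Tr
  stateTransitions q = closeT q ∷ concatMap (λ x → concatMap (modeTransitions q x) modes) (allFin (suc n))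

  transitions : List Tr
  transitions = concatMap stateTransitions (allFin Q)

  M : OCA (suc n)
  M = record { Q = Q * 4 ; init = ⟨ q₀ , fresh ⟩ ; final = λ p → isFinal (decode p) ; δ = transitions }

  close∈ : ∀ q → closeT q ∈ transitions
  close∈ q = ∈-concatMap⁺ stateTransitions (lose (∈-allFin q) (here refl))

  key∈ : ∀ q x m {k t} → classify x ≡ k → t ∈ keyTransitions q x m k → t ∈ transitions
  key∈ q x m {t = t} cl t∈ = ∈-concatMap⁺ stateTransitions (lose (∈-allFin q) (there
    (∈-concatMap⁺ (λ x → concatMap (modeTransitions q x) modes) (lose (∈-allFin x)
      (∈-concatMap⁺ (modeTransitions q x) (lose (mode∈modes m)
        (subst (λ k → t ∈ keyTransitions q x m k) (sym cl) t∈)))))))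

  transition-kind : ∀ {t} → t ∈ transitions →
    ∃ λ q → (t ≡ closeT q) ⊎ (∃ λ x → ∃ λ m → t ∈ keyTransitions q x m (classify x))
  transition-kind t∈ with satisfied (∈-concatMap⁻ stateTransitions {xs = allFin Q} t∈)
  ... | q , here refl = q , inj₁ refl
  ... | q , there t∈′
    with satisfied (∈-concatMap⁻ (λ x → concatMap (modeTransitions q x) modes) {xs = allFin (suc n)} t∈′)
  ...   | x , t∈″ with satisfied (∈-concatMap⁻ (modeTransitions q x) {xs = modes} t∈″)
  ...     | m , t∈‴ = q , inj₂ (x , m , t∈‴)

  ModeOK : Mode → List (Fin (suc n)) → List (Fin n) → ℕ → Set
  ModeOK fresh u w c = (u ≡ []) × (w ≡ [])
  ModeOK idle u w c = ⊤
  ModeOK committed u w c = w ≢ []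
  ModeOK closed u w c = (w ≢ []) × (c ≡ 0)

  afterKey-ok : ∀ m {u w c u′ c′} → ModeOK m u w c → ModeOK (afterKey m) u′ w c′
  afterKey-ok fresh _ = tt
  afterKey-ok idle _ = tt
  afterKey-ok committed w≢[] = w≢[]
  afterKey-ok closed _ = tt

  -- Soundness invariant: the keys u lead to DFA state q, mode m and counter c
  -- when u types the c pending letters on top of a committed word w read by
  -- the DFA into state q.
  record Explains (u : List (Fin (suc n))) (q : Fin Q) (m : Mode) (c : ℕ) : Set where
    constructor explains
    field
      w       : List (Fin n)
      pending : List (Fin n)
      reads   : runDFA D q₀ w ≡ q
      counts  : length pending ≡ c
      types   : screen u ≡ just (pending ++ reverse w)
      modeOK  : ModeOK m u w c

  close-ok : ∀ {c c′ u q} → StackStep true 0 c c′ → Explains u q committed c →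
    Explains (u ++ []) q closed c′
  close-ok {u = u} (onBottom _) (explains w [] reads refl types w≢[]) =
    explains w [] reads refl (subst (λ z → screen z ≡ just (reverse w)) (sym (++-identityʳ u)) types)
             (w≢[] , refl)

  commit-ok : ∀ {c c′ u q m x a} → classify x ≡ just a → StackStep true 0 c c′ → Explains u q m c →
    Explains (u ∷ʳ x) (DFA.δ D q a) committed c′
  commit-ok {u = u} {a = a} cl (onBottom _) (explains w [] refl refl types _) =
    explains (w ∷ʳ a) [] (runDFA-++ D q₀ w (a ∷ []))  refl
             (trans (screen-snoc u types (stepBS-letter cl (reverse w))) (cong just (sym (reverse-++ w (a ∷ [])))))
             (λ e → ∷≢[] (++-conicalʳ w (a ∷ []) e))

  pend₀-ok : ∀ {c c′ u q m x a} → classify x ≡ just a → StackStep true 1 c c′ → Explains u q m c →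
    Explains (u ∷ʳ x) q (afterKey m) c′
  pend₀-ok {u = u} {m = m} {a = a} cl (onBottom _) (explains w [] reads refl types ok) =
    explains w (a ∷ []) reads refl (screen-snoc u types (stepBS-letter cl (reverse w))) (afterKey-ok m ok)

  pend-ok : ∀ {c c′ u q m x a} → classify x ≡ just a → StackStep false 2 c c′ → Explains u q m c →
    Explains (u ∷ʳ x) q (afterKey m) c′
  pend-ok {u = u} {m = m} {a = a} cl (onZ _ c) (explains w pending reads counts types ok) =
    explains w (a ∷ pending) reads (trans (cong suc counts) (+-comm 2 c))
             (screen-snoc u types (stepBS-letter cl (pending ++ reverse w))) (afterKey-ok m ok)

  pop-ok : ∀ {c c′ u q m x} → classify x ≡ nothing → StackStep false 0 c c′ → Explains u q m c →
    Explains (u ∷ʳ x) q (afterKey m) c′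
  pop-ok {u = u} {m = m} cl (onZ _ c) (explains w (y ∷ pending) reads counts types ok) =
    explains w pending reads (trans (suc-injective counts) (sym (+-identityʳ c)))
             (screen-snoc u types (stepBS-erase cl (y ∷ pending ++ reverse w))) (afterKey-ok m ok)

  Sound : Tr → Set
  Sound t = ∀ {c c′ u} → StackStep (Trans.onZ0 t) (Trans.push t) c c′ →
    Explains u (proj₁ (decode (Trans.from t))) (proj₂ (decode (Trans.from t))) c →
    Explains (u ++ inputWord (Trans.input t)) (proj₁ (decode (Trans.to t))) (proj₂ (decode (Trans.to t))) c′

  sound-between : ∀ {t} q m q′ m′ → Trans.from t ≡ ⟨ q , m ⟩ → Trans.to t ≡ ⟨ q′ , m′ ⟩ →
    (∀ {c c′ u} → StackStep (Trans.onZ0 t) (Trans.push t) c c′ → Explains u q m c →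
       Explains (u ++ inputWord (Trans.input t)) q′ m′ c′) → Sound t
  sound-between {t} q m q′ m′ refl refl ok {c} {c′} {u} ss h =
    subst (λ s → Explains (u ++ inputWord (Trans.input t)) (proj₁ s) (proj₂ s) c′)
          (sym (decode-⟨⟩ q′ m′))
      (ok ss (subst (λ s → Explains u (proj₁ s) (proj₂ s) c) (decode-⟨⟩ q m) h))

  key-sound : ∀ q x m {k} → classify x ≡ k → All Sound (keyTransitions q x m k)
  key-sound q x m {just a} cl = sound-between q m _ committed refl refl (commit-ok cl)
                              ∷ sound-between q m q (afterKey m) refl refl (pend₀-ok cl)
                              ∷ sound-between q m q (afterKey m) refl refl (pend-ok cl) ∷ []
  key-sound q x m {nothing} cl = sound-between q m q (afterKey m) refl refl (pop-ok cl) ∷ []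

  transition-sound : ∀ {t} → t ∈ transitions → Sound t
  transition-sound t∈ with transition-kind t∈
  ... | q , inj₁ refl = sound-between q committed q closed refl refl close-ok
  ... | q , inj₂ (x , m , t∈′) = lookup (key-sound q x m refl) t∈′

  explains-reach : ∀ {p c u p′ c′} → Reach M (p , c) u (p′ , c′) → ∀ {u₀} →
    Explains u₀ (proj₁ (decode p)) (proj₂ (decode p)) c →
    Explains (u₀ ++ u) (proj₁ (decode p′)) (proj₂ (decode p′)) c′
  explains-reach (done _) {u₀} h = subst (λ z → Explains z _ _ _) (sym (++-identityʳ u₀)) h
  explains-reach (step {w = u} t t∈ refl ss rest) {u₀} h =
    subst (λ z → Explains z _ _ _) (++-assoc u₀ (inputWord (Trans.input t)) u)
          (explains-reach rest (transition-sound t∈ ss h))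

  explains-start : Explains [] (proj₁ (decode ⟨ q₀ , fresh ⟩)) (proj₂ (decode ⟨ q₀ , fresh ⟩)) 0
  explains-start = subst (λ s → Explains [] (proj₁ s) (proj₂ s) 0) (sym (decode-⟨⟩ q₀ fresh))
                         (explains [] [] refl refl refl (refl , refl))

  final-typing : ∀ {u q c} m → Explains u q m c → T (isFinal (q , m)) → Typing L u
  final-typing fresh (explains w pending refl _ _ (refl , refl)) fin =
    [] , Equivalence.from (D-accepts []) fin , refl , λ _ → refl
  final-typing closed (explains w [] refl _ types (w≢[] , refl)) fin =
    w , Equivalence.from (D-accepts w) fin , types , λ e → ⊥-elim (w≢[] e)
  final-typing idle _ ()
  final-typing committed _ ()

  sound : ∀ u → AcceptsOCA M u → Typing L u
  sound u (p , c , run , fin) = final-typing (proj₂ (decode p)) (explains-reach run explains-start) fin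

  Reach-++ : ∀ {c₁ u c₂ v c₃} → Reach M c₁ u c₂ → Reach M c₂ v c₃ → Reach M c₁ (u ++ v) c₃
  Reach-++ (done _) r = r
  Reach-++ (step t t∈ e ss r₁) r₂ =
    subst (λ z → Reach M _ z _) (sym (++-assoc (inputWord (Trans.input t)) _ _))
          (step t t∈ e ss (Reach-++ r₁ r₂))

  fire : ∀ {c₀ u c c′} t → Reach M c₀ u (Trans.from t , c) → t ∈ transitions →
    StackStep (Trans.onZ0 t) (Trans.push t) c c′ →
    Reach M c₀ (u ++ inputWord (Trans.input t)) (Trans.to t , c′)
  fire t r t∈ ss = Reach-++ r (subst (λ z → Reach M _ z _) (++-identityʳ _) (step t t∈ refl ss (done _)))

  Run : List (Fin (suc n)) → Fin Q → Mode → ℕ → Set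
  Run u q m c = Reach M (⟨ q₀ , fresh ⟩ , 0) u (⟨ q , m ⟩ , c)

  run-commit : ∀ {u q m x a} → classify x ≡ just a → Run u q m 0 →
    Run (u ∷ʳ x) (DFA.δ D q a) committed 0
  run-commit {q = q} {m} {x} {a} cl r = fire (commitT q x m a) r (key∈ q x m cl (here refl)) (onBottom 0)

  run-pend : ∀ {u q m c x a} → classify x ≡ just a → Run u q m c → Run (u ∷ʳ x) q (afterKey m) (suc c)
  run-pend {q = q} {m} {zero} {x} cl r = fire (pendT₀ q x m) r (key∈ q x m cl (there (here refl))) (onBottom 1)
  run-pend {u = u} {q} {m} {suc c} {x} cl r = subst (Run (u ∷ʳ x) q (afterKey m)) (+-comm c 2)
    (fire (pendT q x m) r (key∈ q x m cl (there (there (here refl)))) (onZ 2 c))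

  run-pop : ∀ {u q m c x} → classify x ≡ nothing → Run u q m (suc c) → Run (u ∷ʳ x) q (afterKey m) c
  run-pop {u} {q} {m} {c} {x} cl r = subst (Run (u ∷ʳ x) q (afterKey m)) (+-identityʳ c)
    (fire (popT q x m) r (key∈ q x m cl (here refl)) (onZ 0 c))

  -- Completeness invariant: if u types the letters ts on top of the word w,
  -- then reading u the automaton can treat ts as pending and w as committed.
  reachable : ∀ u → Reverse u → ∀ ts w → screen u ≡ just (ts ++ reverse w) →
    ∃ λ m → (w ≢ [] → m ≡ committed) × Run u (runDFA D q₀ w) m (length ts)
  reachable .[] [] [] [] _ = fresh , (λ w≢[] → ⊥-elim (w≢[] refl)) , done _
  reachable .[] [] [] (a ∷ w) e =
    ⊥-elim (0≢1+n (trans (cong length (just-injective e)) (length-reverse (a ∷ w))))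
  reachable .[] [] (_ ∷ _) w ()
  reachable .(u ∷ʳ x) (u ∶ rv ∶ʳ x) ts w e with screen-last u x e | keyView x
  ... | r , er , ex | erase cl with stepBS-erase-inv cl ex
  ...   | y , refl with reachable u rv (y ∷ ts) w er
  ...     | m , forced , run = afterKey m , (λ w≢[] → cong afterKey (forced w≢[])) , run-pop cl run
  reachable .(u ∷ʳ x) (u ∶ rv ∶ʳ x) (b ∷ ts) w e | r , er , ex | letter a cl
    with ∷-injective (stepBS-letter-inv cl ex)
  ... | refl , refl with reachable u rv ts w er
  ...   | m , forced , run = afterKey m , (λ w≢[] → cong afterKey (forced w≢[])) , run-pend cl run
  reachable .(u ∷ʳ x) (u ∶ rv ∶ʳ x) [] w e | r , er , ex | letter a cl
    with reachable u rv [] (reverse r) (trans er (cong just (sym (reverse-involutive r))))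
  ... | m , _ , run =
        committed , (λ _ → refl) , subst (λ q → Run (u ∷ʳ x) q committed 0) (sym w-state) (run-commit cl run)
    where
    w≡ : w ≡ reverse r ∷ʳ a
    w≡ = trans (sym (reverse-involutive w)) (trans (cong reverse (stepBS-letter-inv cl ex)) (unfold-reverse a r))
    w-state : runDFA D q₀ w ≡ DFA.δ D (runDFA D q₀ (reverse r)) a
    w-state = trans (cong (runDFA D q₀) w≡) (runDFA-++ D q₀ (reverse r) (a ∷ []))

  complete : ∀ u → Typing L u → AcceptsOCA M u
  complete u (w , inL , types , empty) with w
  ... | [] rewrite empty refl =
    ⟨ q₀ , fresh ⟩ , 0 , done _ ,
    subst (λ s → T (isFinal s)) (sym (decode-⟨⟩ q₀ fresh)) (Equivalence.to (D-accepts []) inL)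
  ... | a ∷ w′ with reachable u (reverseView u) [] (a ∷ w′) types
  ...   | m , forced , run with forced (λ ())
  ...     | refl = ⟨ q , closed ⟩ , 0 ,
            subst (λ z → Reach M (⟨ q₀ , fresh ⟩ , 0) z (⟨ q , closed ⟩ , 0)) (++-identityʳ u)
                  (fire (closeT q) run (close∈ q) (onBottom 0)) ,
            subst (λ s → T (isFinal s)) (sym (decode-⟨⟩ q closed))
                  (Equivalence.to (D-accepts (a ∷ w′)) inL)
    where
    q : Fin Q
    q = runDFA D q₀ (a ∷ w′)

typing-OCL : ∀ {n} (L : Lang n) → IsRegular L → IsOCL (Typing L)
typing-OCL L (D , D-accepts) = M , λ u → mk⇔ (complete u) (sound u)
  where open Automaton L D D-accepts

isOCL-cong : ∀ {m} {A B : Lang m} → IsOCL A → (∀ u → A u ⇔ B u) → IsOCL B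
isOCL-cong (M , accepts) A⇔B = M , λ u → accepts u ⇔-∘ ⇔-sym (A⇔B u)

-- Each Types a is a one-counter language: it is Typing of the regular
-- language {a}.

module Singleton {n} (a : Fin n) where

  -- states: 0 initial, 1 after reading exactly a, 2 dead
  move : Fin 3 → Fin n → Fin 3
  move zero b with b ≟ a
  ... | yes _ = suc zero
  ... | no _ = suc (suc zero)
  move _ _ = suc (suc zero)

  accepting : Fin 3 → Bool
  accepting (suc zero) = true
  accepting _ = false

  dfa : DFA n
  dfa = record { Q = 3 ; init = zero ; final = accepting ; δ = move }

  dead : ∀ w → runDFA dfa (suc (suc zero)) w ≡ suc (suc zero)
  dead [] = refl
  dead (_ ∷ w) = dead w

  regular : IsRegular (λ w → w ≡ a ∷ [])
  regular = dfa , λ w → mk⇔ (accepts w) (only w)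
    where
    accepts : ∀ w → w ≡ a ∷ [] → T (accepting (runDFA dfa zero w))
    accepts _ refl with a ≟ a
    ... | yes _ = tt
    ... | no a≢a = a≢a refl
    only : ∀ w → T (accepting (runDFA dfa zero w)) → w ≡ a ∷ []
    only [] ()
    only (b ∷ w) acc with b ≟ a
    only (b ∷ []) acc | yes refl = refl
    only (b ∷ _ ∷ w) acc | yes refl rewrite dead w = ⊥-elim acc
    only (b ∷ w) acc | no _ rewrite dead w = ⊥-elim acc

types-OCL : ∀ {n} (a : Fin n) → IsOCL (Types a)
types-OCL a = isOCL-cong (typing-OCL _ (Singleton.regular a)) λ u →
  mk⇔ (λ { (_ , refl , types , _) → screen⇒backspace u types })
      (λ bs → a ∷ [] , refl , backspace⇒screen u bs , λ ())

subst-OCLk : ∀ {n} (L : Lang n) k → OCLk k n L → OCLk (suc k) (suc n) (Subst Types L)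
subst-OCLk L zero (lift regular) =
  lift (isOCL-cong (typing-OCL L regular) (λ u → ⇔-sym (Subst-Types⇔Typing L u)))
subst-OCLk {n} L (suc k) inOCLk = n , L , inOCLk , Types , types-OCL , λ w → mk⇔ (λ h → h) (λ h → h)

mainTheorem1 : (n : ℕ) (LA : Lang n) →
    Σ (Lang (suc n)) (λ EA → ∀ σ → Approx (OmegaPower LA) σ ⇔ OmegaPower EA σ)
    × (∀ k → OCLk k n LA →
        Σ (Lang (suc n)) (λ EA → OCLk (suc k) (suc n) EA
          × (∀ σ → Approx (OmegaPower LA) σ ⇔ OmegaPower EA σ)))
mainTheorem1 n LA =
  (Subst Types LA , approx⇔omegaPower-Subst LA) ,
  λ k LA∈OCLk → Subst Types LA , subst-OCLk LA k LA∈OCLk , approx⇔omegaPower-Subst LA
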